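{- Let $G$ be a complete bipartite graph (finite, simple, connected). Then every maximal independent set of $G$ is robust.
   Context: A connected spanning subgraph of $G=(V,E_G)$ is a connected graph $H=(V,E_H)$ with $E_H\subseteq E_G$. A maximal independent set (MIS) is a set of pairwise non-adjacent vertices maximal for inclusion. An MIS $S$ of $G$ is robust if $S$ is a maximal independent set in every connected spanning subgraph of $G$ (including $G$ itself). A complete bipartite graph is a graph whose vertex set is partitioned into two disjoint sets $V_1,V_2$ such that the edge set is exactly $\{\{v_1,v_2\}: v_1\in V_1, v_2\in V_2\}$. -}

module Defs where

open import Data.Nat using (ℕ)
open import Data.Fin using (Fin)
open import Data.Bool using (Bool; true; false)
open import Data.Fin.Subset using (Subset; _∈_; _⊆_)
open import Data.Product using (_×_; Σ; _,_)
open import Relation.Nullary using (¬_)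
open import Relation.Binary.PropositionalEquality using (_≡_; _≢_)

record Graph (n : ℕ) : Set where
  field
    adj    : Fin n → Fin n → Bool
    sym    : ∀ u v → adj u v ≡ true → adj v u ≡ true
    irrefl : ∀ v → adj v v ≢ true

open Graph public

Adj : ∀ {n} → Graph n → Fin n → Fin n → Set
Adj G u v = adj G u v ≡ true

data Walk {n} (G : Graph n) : Fin n → Fin n → Set where
  [] : ∀ {v} → Walk G v v
  _∷_ : ∀ {u w v} → Adj G u w → Walk G w v → Walk G u v

Connected : ∀ {n} → Graph n → Set
Connected G = ∀ u v → Walk G u v

SpanningSubgraph : ∀ {n} → Graph n → Graph n → Set
SpanningSubgraph H G = ∀ u v → Adj H u v → Adj G u v

ConnectedSpanningSubgraph : ∀ {n} → Graph n → Graph n → Set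
ConnectedSpanningSubgraph H G = SpanningSubgraph H G × Connected H

Independent : ∀ {n} → Graph n → Subset n → Set
Independent G S = ∀ u v → u ∈ S → v ∈ S → ¬ Adj G u v

MaximalIndependentSet : ∀ {n} → Graph n → Subset n → Set
MaximalIndependentSet G S =
  Independent G S × (∀ T → Independent G T → S ⊆ T → T ⊆ S)

Robust : ∀ {n} → Graph n → Subset n → Set
Robust G S = ∀ H → ConnectedSpanningSubgraph H G → MaximalIndependentSet H S

CompleteBipartite : ∀ {n} → Graph n → Set
CompleteBipartite {n} G =
  Σ (Fin n → Bool) λ side → ∀ u v → (Adj G u v → side u ≢ side v) × (side u ≢ side v → Adj G u v)

-- In a complete bipartite graph two vertices on the same side are never
-- adjacent, so a maximal independent set S (nonempty by maximality) is a
-- whole side.  If T ⊇ S is independent in a connected spanning subgraph H and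
-- t ∈ T lies outside S, then t is on the other side; the first edge of an
-- H-walk from t to S leads to a vertex w on the opposite side of t, i.e.
-- w ∈ S ⊆ T, contradicting the independence of T.
module Submission where

open import Defs hiding (sym)
open import Data.Nat using (ℕ)
open import Data.Fin using (Fin)
open import Data.Bool using (Bool; _≟_)
open import Data.Bool.Properties using (¬-not)
open import Data.Fin.Subset using (Subset; _∈_; _⊆_; _∪_; ⁅_⁆; Nonempty)
open import Data.Fin.Subset.Properties
  using (nonempty?; x∈⁅x⁆; x∈⁅y⁆⇒x≡y; x∈p∪q⁻; x∈p∪q⁺)
open import Data.Product using (_,_; proj₁; proj₂)
open import Data.Sum using (inj₁; inj₂)
open import Relation.Nullary using (yes; no; contradiction)
open import Relation.Nullary.Decidable using (decidable-stable)
open import Relation.Binary.PropositionalEquality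
  using (_≡_; _≢_; refl; sym; trans)

private
  variable
    n : ℕ

≢-same⇒≡ : ∀ {a b c : Bool} → a ≢ c → b ≢ c → a ≡ b
≢-same⇒≡ a≢c b≢c = trans (¬-not a≢c) (sym (¬-not b≢c))

Independent-spanning : ∀ {G H : Graph n} {S : Subset n} →
  SpanningSubgraph H G → Independent G S → Independent H S
Independent-spanning H⊆G indS u v u∈S v∈S uv = indS u v u∈S v∈S (H⊆G u v uv)

Independent-⁅⁆ : (G : Graph n) (v : Fin n) → Independent G ⁅ v ⁆
Independent-⁅⁆ G v u w u∈ w∈ uw with x∈⁅y⁆⇒x≡y v u∈ | x∈⁅y⁆⇒x≡y v w∈
... | refl | refl = irrefl G v uw

module _ (G : Graph n) {S : Subset n} (misS : MaximalIndependentSet G S) where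

  maximal-absorbs : ∀ {x} → Independent G (S ∪ ⁅ x ⁆) → x ∈ S
  maximal-absorbs {x} ind =
    proj₂ misS (S ∪ ⁅ x ⁆) ind (λ s∈S → x∈p∪q⁺ (inj₁ s∈S)) (x∈p∪q⁺ (inj₂ (x∈⁅x⁆ x)))

  maximal-nonempty : Fin n → Nonempty S
  maximal-nonempty v with nonempty? S
  ... | yes neS = neS
  ... | no emptyS =
    v , proj₂ misS ⁅ v ⁆ (Independent-⁅⁆ G v)
          (λ {u} u∈S → contradiction (u , u∈S) emptyS) (x∈⁅x⁆ v)

module CompleteBipartiteMIS (G : Graph n) (cbG : CompleteBipartite G)
                            {S : Subset n} (misS : MaximalIndependentSet G S) where

  side : Fin n → Bool
  side = proj₁ cbG

  adj⇒side≢ : ∀ {u v} → Adj G u v → side u ≢ side v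
  adj⇒side≢ {u} {v} = proj₁ (proj₂ cbG u v)

  side≢⇒adj : ∀ {u v} → side u ≢ side v → Adj G u v
  side≢⇒adj {u} {v} = proj₂ (proj₂ cbG u v)

  ∈⇒sameSide : ∀ {u v} → u ∈ S → v ∈ S → side u ≡ side v
  ∈⇒sameSide {u} {v} u∈S v∈S =
    decidable-stable (side u ≟ side v)
      (λ u≢v → proj₁ misS u v u∈S v∈S (side≢⇒adj u≢v))

  sameSide⇒∈ : ∀ {s x} → s ∈ S → side x ≡ side s → x ∈ S
  sameSide⇒∈ {s} {x} s∈S x≡s = maximal-absorbs G misS independent
    where
    onSide : ∀ {u} → u ∈ S ∪ ⁅ x ⁆ → side u ≡ side s
    onSide u∈ with x∈p∪q⁻ S ⁅ x ⁆ u∈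
    ... | inj₁ u∈S = ∈⇒sameSide u∈S s∈S
    ... | inj₂ u∈x with x∈⁅y⁆⇒x≡y x u∈x
    ...   | refl = x≡s

    independent : Independent G (S ∪ ⁅ x ⁆)
    independent u v u∈ v∈ uv = adj⇒side≢ uv (trans (onSide u∈) (sym (onSide v∈)))

  maximal-in-spanning : ∀ {H} → ConnectedSpanningSubgraph H G →
    ∀ T → Independent H T → S ⊆ T → T ⊆ S
  maximal-in-spanning (H⊆G , connH) T indT S⊆T {t} t∈T
    with maximal-nonempty G misS t
  ... | s , s∈S with connH t s
  ...   | [] = s∈S
  ...   | _∷_ {w = w} tw _ with side t ≟ side s
  ...     | yes t≡s = sameSide⇒∈ s∈S t≡s
  ...     | no t≢s = contradiction tw (indT t w t∈T (S⊆T w∈S))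
    where
    w∈S : w ∈ S
    w∈S = sameSide⇒∈ s∈S
            (≢-same⇒≡ (λ w≡t → adj⇒side≢ (H⊆G t w tw) (sym w≡t))
                      (λ s≡t → t≢s (sym s≡t)))

lemma1 : ∀ {n} (G : Graph n) → CompleteBipartite G → Connected G →
    ∀ (S : Subset n) → MaximalIndependentSet G S → Robust G S
lemma1 G cbG _ S misS H spanH =
  Independent-spanning {G = G} {H} (proj₁ spanH) (proj₁ misS) , maximal-in-spanning spanH
  where open CompleteBipartiteMIS G cbG misS
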